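{- (Path lifting) Let $m\ge n\ge1$. Every path in $G_n$ of length at least $m-n$ (finite or infinite) is of the form $\pi_{m,n}(q)$ for some path $q$ in $G_m$. Moreover, the image of $\pi_n$ restricted to $S_\infty$ is the set $\mathrm{Path}_\infty(G_n)$ of all infinite paths in $G_n$.
   Context: For distinct reals $y_1,\dots,y_k$, $\mathrm{Order}(y_1,\dots,y_k)$ is the unique $\sigma\in S_k$ with $y_i<y_j$ iff $\sigma(i)<\sigma(j)$. $\rho,\rho':S_{k+1}\to S_k$: $\rho(\sigma)=\mathrm{Order}(\sigma(1),\dots,\sigma(k))$, $\rho'(\sigma)=\mathrm{Order}(\sigma(2),\dots,\sigma(k+1))$. The permutation digraph $G_k$ has vertex set $S_k$ and edge set $S_{k+1}$, the edge $e$ directed from $\rho(e)$ to $\rho'(e)$. A path of length $\ell$ ($0\le\ell<\infty$) is $(v_0,e_1,v_1,\dots,e_\ell,v_\ell)$ with $e_i$ directed from $v_{i-1}$ to $v_i$; an infinite path is $(v_0,e_1,v_1,\dots)$ each of whose finite initial segments ending in a vertex is a path. For a (finite or infinite) path $p=(v_0,e_1,v_1,\dots)$ in $G_{k+1}$, $\pi_{k+1,k}(p)$ is the concatenation of the length-one paths $(\rho(v_i),v_i,\rho'(v_i))$ in $G_k$, i.e. $(\rho(v_0),v_0,\rho'(v_0),v_1,\rho'(v_1),\dots)$; it has length $\ell+1$ if $p$ has length $\ell$. Set $\pi_{m,k}=\pi_{k+1,k}\circ\cdots\circ\pi_{m,m-1}$ for $m>k$ and $\pi_{k,k}=\mathrm{id}$.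 $S_\infty$ is the set of sequences $(\sigma_1,\sigma_2,\dots)$ with $\sigma_i\in S_i$ and $\rho(\sigma_{i+1})=\sigma_i$ for all $i$. For $\sigma\in S_\infty$, $\pi_n(\sigma)$ is the infinite path in $G_n$ whose initial subpath of length $\ell$ is $\pi_{\ell+n,n}(\sigma_{\ell+n})$ for every $\ell\ge0$ (where $\sigma_{\ell+n}$ is viewed as a length-$0$ path in $G_{\ell+n}$). -}

module Defs where

open import Data.Nat using (ℕ; zero; suc; _+_; _<_; _≤_; _<?_)
open import Data.Fin using (Fin)
open import Data.Vec using (Vec; []; _∷_; lookup; map; count; init; tail)
open import Data.List using (List; []; _∷_; length; applyUpTo)
import Data.List as L
open import Data.Product using (Σ; _×_; _,_; proj₁; proj₂)
open import Data.Unit using (⊤)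
open import Relation.Binary.PropositionalEquality using (_≡_)

-- Permutations of size k are represented in one-line notation as vectors
-- (σ(1),…,σ(k)) with values shifted to 0,…,k-1.
IsPerm : (k : ℕ) → Vec ℕ k → Set
IsPerm k v = (∀ i → lookup v i < k) × (∀ (i j : Fin k) → lookup v i ≡ lookup v j → i ≡ j)

Order : {k : ℕ} → Vec ℕ k → Vec ℕ k
Order ys = map (λ y → count (_<? y) ys) ys

ρ : {k : ℕ} → Vec ℕ (suc k) → Vec ℕ k
ρ σ = Order (init σ)

ρ′ : {k : ℕ} → Vec ℕ (suc k) → Vec ℕ k
ρ′ σ = Order (tail σ)

-- A (raw) finite walk in G_k: the starting vertex v₀ followed by the list of
-- steps (e_i , v_i), i = 1 … ℓ.  Its length is the length of the list.
Walk : ℕ → Set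
Walk k = Vec ℕ k × List (Vec ℕ (suc k) × Vec ℕ k)

len : {k : ℕ} → Walk k → ℕ
len w = length (proj₂ w)

PathFrom : {k : ℕ} → Vec ℕ k → List (Vec ℕ (suc k) × Vec ℕ k) → Set
PathFrom v [] = ⊤
PathFrom {k} v ((e , w) ∷ rest) =
  IsPerm (suc k) e × ρ e ≡ v × ρ′ e ≡ w × IsPerm k w × PathFrom w rest

IsPath : {k : ℕ} → Walk k → Set
IsPath {k} (v₀ , steps) = IsPerm k v₀ × PathFrom v₀ steps

-- A (raw) infinite walk: v₀ and the steps (e_{i+1} , v_{i+1}) for i : ℕ.
InfWalk : ℕ → Set
InfWalk k = Vec ℕ k × (ℕ → Vec ℕ (suc k) × Vec ℕ k)

vertexAt : {k : ℕ} → InfWalk k → ℕ → Vec ℕ k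
vertexAt (v₀ , s) zero = v₀
vertexAt (v₀ , s) (suc i) = proj₂ (s i)

IsInfPath : {k : ℕ} → InfWalk k → Set
IsInfPath {k} w =
  IsPerm k (proj₁ w) ×
  (∀ i → IsPerm (suc k) (proj₁ (proj₂ w i)) ×
         ρ (proj₁ (proj₂ w i)) ≡ vertexAt w i ×
         ρ′ (proj₁ (proj₂ w i)) ≡ vertexAt w (suc i) ×
         IsPerm k (proj₂ (proj₂ w i)))

_≈∞_ : {k : ℕ} → InfWalk k → InfWalk k → Set
w ≈∞ w′ = proj₁ w ≡ proj₁ w′ × (∀ i → proj₂ w i ≡ proj₂ w′ i)

takeInf : {k : ℕ} → ℕ → InfWalk k → Walk k
takeInf ℓ (v₀ , s) = v₀ , applyUpTo s ℓ

π1 : {k : ℕ} → Walk (suc k) → Walk k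
π1 (v₀ , steps) = ρ v₀ , (v₀ , ρ′ v₀) ∷ L.map (λ st → proj₂ st , ρ′ (proj₂ st)) steps

π1∞ : {k : ℕ} → InfWalk (suc k) → InfWalk k
π1∞ (v₀ , s) = ρ v₀ , λ { zero → v₀ , ρ′ v₀
                        ; (suc i) → proj₂ (s i) , ρ′ (proj₂ (s i)) }

π : (d : ℕ) {n : ℕ} → Walk (d + n) → Walk n
π zero w = w
π (suc d) w = π d (π1 w)

π∞ : (d : ℕ) {n : ℕ} → InfWalk (d + n) → InfWalk n
π∞ zero w = w
π∞ (suc d) w = π∞ d (π1∞ w)

IsSInf : ((i : ℕ) → Vec ℕ i) → Set
IsSInf σ = (∀ i → IsPerm i (σ i)) × (∀ i → ρ (σ (suc i)) ≡ σ i)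

-- "p is π_n(σ)": the initial subpath of p of length ℓ is π_{ℓ+n,n}(σ_{ℓ+n})
IsπInf : (n : ℕ) → ((i : ℕ) → Vec ℕ i) → InfWalk n → Set
IsπInf n σ p = ∀ ℓ → takeInf ℓ p ≡ π ℓ (σ (ℓ + n) , [])

-- A path (v₀, e₁, v₁, …) of G_k is lifted one level by taking the edges eᵢ as
-- the new vertices and, for each pair of consecutive edges eᵢ, eᵢ₊₁ (whose
-- patterns overlap in vᵢ), an edge f of G_{k+1} with ρ f = eᵢ and ρ′ f = eᵢ₊₁.
-- Such an f exists because a sequence can always be extended by one entry
-- placed, relative to its last k entries, as the last entry of eᵢ₊₁ is placed
-- relative to the others: make the old entries odd and choose an even value in
-- the right gap. The same extension, applied to
-- v₀ successively with e₁, e₂, …, produces a coherent sequence of permutations,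
-- i.e. an element σ of S_∞, whose windows of n + 1 consecutive entries realise
-- the edges of a given infinite path; that path is therefore π_n(σ). Conversely
-- π_n(σ) is an infinite path because all its finite prefixes π_{ℓ+n,n}(σ_{ℓ+n}) are paths.

module Submission where

open import Defs
open import Data.Nat using (ℕ; zero; suc; _+_; _*_; _≤_; _<_; _≮_; _<?_; z≤n; s≤s; z<s; _∸_; _⊔_)
open import Data.Nat.Properties
open import Data.Fin using (Fin; toℕ; fromℕ<)
import Data.Fin as Fin
open import Data.Fin.Properties using (toℕ-injective; toℕ<n; toℕ-fromℕ<)
open import Data.Vec using (Vec; []; _∷_; lookup; map; count; init; tail; last; _∷ʳ_; truncate; drop; initLast)
open import Data.Vec.Properties using (init-∷ʳ; drop-map; count≤n)
open import Data.List using (List; []; _∷_; applyUpTo)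
import Data.List as List
import Data.List.Properties as List
open import Data.Product using (Σ; _×_; _,_; proj₁; proj₂)
open import Data.Sum using (_⊎_; inj₁; inj₂)
open import Data.Unit using (tt)
open import Data.Empty using (⊥-elim)
open import Function using (_∘_; _⇔_; mk⇔; Equivalence)
import Function.Properties.Equivalence as ⇔
open import Relation.Nullary using (yes; no; contradiction)
open import Relation.Nullary.Decidable using (dec-true; dec-false)
open import Relation.Binary using (tri<; tri≈; tri>)
open import Relation.Binary.PropositionalEquality

open Equivalence using (to; from)

-- Total indexing by a natural number (junk value 0 out of range), so that
-- vectors of different lengths can be compared position by position.
infixl 9 _!_
_!_ : ∀ {k} → Vec ℕ k → ℕ → ℕ
[] ! _ = 0
(x ∷ xs) ! zero = x
(x ∷ xs) ! suc i = xs ! i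

lookup≡! : ∀ {k} (v : Vec ℕ k) (i : Fin k) → lookup v i ≡ v ! toℕ i
lookup≡! (x ∷ v) Fin.zero = refl
lookup≡! (x ∷ v) (Fin.suc i) = lookup≡! v i

onTail : ∀ {k} {P : ℕ → Set} → (∀ i → i < suc k → P i) → ∀ i → i < k → P (suc i)
onTail h i i<k = h (suc i) (s≤s i<k)

!-ext : ∀ {k} (u v : Vec ℕ k) → (∀ i → i < k → u ! i ≡ v ! i) → u ≡ v
!-ext [] [] _ = refl
!-ext (x ∷ u) (y ∷ v) eq = cong₂ _∷_ (eq 0 z<s) (!-ext u v λ i i<k → eq (suc i) (s≤s i<k))

!-map : ∀ {k} (f : ℕ → ℕ) (v : Vec ℕ k) i → i < k → map f v ! i ≡ f (v ! i)
!-map f (x ∷ v) zero _ = refl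
!-map f (x ∷ v) (suc i) (s≤s i<k) = !-map f v i i<k

!-init : ∀ {k} (v : Vec ℕ (suc k)) i → i < k → init v ! i ≡ v ! i
!-init (x ∷ y ∷ v) zero _ = refl
!-init (x ∷ y ∷ v) (suc i) (s≤s i<k) = !-init (y ∷ v) i i<k

!-∷ʳ : ∀ {k} (v : Vec ℕ k) x i → i < k → (v ∷ʳ x) ! i ≡ v ! i
!-∷ʳ (y ∷ v) x zero _ = refl
!-∷ʳ (y ∷ v) x (suc i) (s≤s i<k) = !-∷ʳ v x i i<k

!-∷ʳ-last : ∀ {k} (v : Vec ℕ k) x → (v ∷ʳ x) ! k ≡ x
!-∷ʳ-last [] x = refl
!-∷ʳ-last (y ∷ v) x = !-∷ʳ-last v x

!-truncate : ∀ {m k} (m≤k : m ≤ k) (v : Vec ℕ k) i → i < m → truncate m≤k v ! i ≡ v ! i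
!-truncate (s≤s m≤k) (x ∷ v) zero _ = refl
!-truncate (s≤s m≤k) (x ∷ v) (suc i) (s≤s i<m) = !-truncate m≤k v i i<m

<-suc-cases : ∀ {i k} → i < suc k → i < k ⊎ i ≡ k
<-suc-cases i<1+k = m≤n⇒m<n∨m≡n (≤-pred i<1+k)

Injective : ∀ {k} → Vec ℕ k → Set
Injective {k} v = ∀ i j → i < k → j < k → v ! i ≡ v ! j → i ≡ j

injective-tail : ∀ {k} {x} {v : Vec ℕ k} → Injective (x ∷ v) → Injective v
injective-tail injective i j i<k j<k eq = suc-injective (injective (suc i) (suc j) (s≤s i<k) (s≤s j<k) eq)

injective-init : ∀ {k} {v : Vec ℕ (suc k)} → Injective v → Injective (init v)
injective-init {v = v} injective i j i<k j<k eq =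
  injective i j (m<n⇒m<1+n i<k) (m<n⇒m<1+n j<k) (trans (sym (!-init v i i<k)) (trans eq (!-init v j j<k)))

injective-truncate : ∀ {m k} (m≤k : m ≤ k) {u : Vec ℕ k} → Injective u → Injective (truncate m≤k u)
injective-truncate m≤k {u} u-injective i j i<m j<m eq = u-injective i j (<-≤-trans i<m m≤k) (<-≤-trans j<m m≤k)
  (trans (sym (!-truncate m≤k u i i<m)) (trans eq (!-truncate m≤k u j j<m)))

record Permutation {k} (v : Vec ℕ k) : Set where
  constructor permutation
  field
    bounded : ∀ i → i < k → v ! i < k
    injective : Injective v
open Permutation public

IsPerm⇒Permutation : ∀ {k} {v : Vec ℕ k} → IsPerm k v → Permutation v
IsPerm⇒Permutation {k} {v} (bounded , injective) = permutation
  (λ i i<k → subst (_< k) (!-fromℕ< i<k) (bounded (fromℕ< i<k)))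
  (λ i j i<k j<k eq → trans (sym (toℕ-fromℕ< i<k)) (trans
     (cong toℕ (injective (fromℕ< i<k) (fromℕ< j<k)
        (trans (!-fromℕ< i<k) (trans eq (sym (!-fromℕ< j<k))))))
     (toℕ-fromℕ< j<k)))
  where
  !-fromℕ< : ∀ {i} (i<k : i < k) → lookup v (fromℕ< i<k) ≡ v ! i
  !-fromℕ< i<k = trans (lookup≡! v (fromℕ< i<k)) (cong (v !_) (toℕ-fromℕ< i<k))

Permutation⇒IsPerm : ∀ {k} {v : Vec ℕ k} → Permutation v → IsPerm k v
Permutation⇒IsPerm {k} {v} (permutation bounded injective) =
  (λ i → subst (_< k) (sym (lookup≡! v i)) (bounded (toℕ i) (toℕ<n i))) ,
  (λ i j eq → toℕ-injective (injective (toℕ i) (toℕ j) (toℕ<n i) (toℕ<n j)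
     (trans (sym (lookup≡! v i)) (trans eq (lookup≡! v j)))))

-- Relative order of vectors

record SameOrder {a b} (m : ℕ) (u : Vec ℕ a) (v : Vec ℕ b) : Set where
  constructor sameOrder
  field agree : ∀ i j → i < m → j < m → (u ! i < u ! j) ⇔ (v ! i < v ! j)
open SameOrder public

infix 4 _≅_
_≅_ : ∀ {k} → Vec ℕ k → Vec ℕ k → Set
_≅_ {k} = SameOrder k

private variable
  a b c m : ℕ
  u : Vec ℕ a
  v : Vec ℕ b
  w : Vec ℕ c

SameOrder-refl : SameOrder m u u
SameOrder-refl = sameOrder λ _ _ _ _ → ⇔.refl

SameOrder-sym : SameOrder m u v → SameOrder m v u
SameOrder-sym (sameOrder h) = sameOrder λ i j i<m j<m → ⇔.sym (h i j i<m j<m)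

SameOrder-trans : SameOrder m u v → SameOrder m v w → SameOrder m u w
SameOrder-trans (sameOrder h) (sameOrder h′) =
  sameOrder λ i j i<m j<m → ⇔.trans (h i j i<m j<m) (h′ i j i<m j<m)

SameOrder-mono : ∀ {m′} → m′ ≤ m → SameOrder m u v → SameOrder m′ u v
SameOrder-mono m′≤m (sameOrder h) =
  sameOrder λ i j i<m′ j<m′ → h i j (<-≤-trans i<m′ m′≤m) (<-≤-trans j<m′ m′≤m)

SameOrder-respˡ : (∀ i → i < m → u ! i ≡ w ! i) → SameOrder m u v → SameOrder m w v
SameOrder-respˡ {v = v} eq (sameOrder h) = sameOrder λ i j i<m j<m →
  subst₂ (λ x y → (x < y) ⇔ (v ! i < v ! j)) (eq i i<m) (eq j j<m) (h i j i<m j<m)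

SameOrder-init : ∀ {k b} {u : Vec ℕ (suc k)} {v : Vec ℕ b} → SameOrder k (init u) v ⇔ SameOrder k u v
SameOrder-init {u = u} = mk⇔ (SameOrder-respˡ λ i i<k → !-init u i i<k) (SameOrder-respˡ λ i i<k → sym (!-init u i i<k))

SameOrder-truncate : ∀ {m k a b} (m≤k : m ≤ k) {u : Vec ℕ k} {v : Vec ℕ b} →
  a ≤ m → SameOrder a u v → SameOrder a (truncate m≤k u) v
SameOrder-truncate m≤k {u} a≤m = SameOrder-respˡ λ i i<a → sym (!-truncate m≤k u i (<-≤-trans i<a a≤m))

≡⇒≅ : ∀ {k} {u v : Vec ℕ k} → u ≡ v → u ≅ v
≡⇒≅ refl = SameOrder-refl

≅-init : ∀ {k} {u v : Vec ℕ (suc k)} → u ≅ v → init u ≅ init v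
≅-init {k} h = SameOrder-sym (from SameOrder-init (SameOrder-sym (from SameOrder-init (SameOrder-mono (n≤1+n k) h))))

≅-tail : ∀ {k} {u v : Vec ℕ (suc k)} → u ≅ v → tail u ≅ tail v
≅-tail {u = _ ∷ _} {_ ∷ _} (sameOrder h) =
  sameOrder λ i j i<k j<k → h (suc i) (suc j) (s≤s i<k) (s≤s j<k)

≅-injective : ∀ {k} {u v : Vec ℕ k} → u ≅ v → Injective v → Injective u
≅-injective {u = u} {v} h injective i j i<k j<k eq with <-cmp (v ! i) (v ! j)
... | tri< vi<vj _ _ = contradiction eq (<⇒≢ (from (agree h i j i<k j<k) vi<vj))
... | tri≈ _ vi≡vj _ = injective i j i<k j<k vi≡vj
... | tri> _ _ vj<vi = contradiction (sym eq) (<⇒≢ (from (agree h j i j<k i<k) vj<vi))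

rank : ∀ {k} → ℕ → Vec ℕ k → ℕ
rank a v = count (_<? a) v

rank-∷-< : ∀ {k a x} (v : Vec ℕ k) → x < a → rank a (x ∷ v) ≡ suc (rank a v)
rank-∷-< {a = a} {x} v x<a rewrite dec-true (x <? a) x<a = refl

rank-∷-≮ : ∀ {k a x} (v : Vec ℕ k) → x ≮ a → rank a (x ∷ v) ≡ rank a v
rank-∷-≮ {a = a} {x} v x≮a rewrite dec-false (x <? a) x≮a = refl

rank-zero : ∀ {k} (v : Vec ℕ k) → rank 0 v ≡ 0
rank-zero [] = refl
rank-zero (x ∷ v) rewrite rank-∷-≮ v (n≮0 {x}) = rank-zero v

rank-mono : ∀ {k} a b (v : Vec ℕ k) → (∀ i → i < k → v ! i < a → v ! i < b) → rank a v ≤ rank b v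
rank-mono a b [] _ = z≤n
rank-mono a b (x ∷ v) h with x <? a | x <? b
... | yes x<a | yes x<b rewrite rank-∷-< v x<a | rank-∷-< v x<b = s≤s (rank-mono a b v (onTail h))
... | yes x<a | no x≮b = contradiction (h 0 z<s x<a) x≮b
... | no x≮a | yes x<b rewrite rank-∷-≮ v x≮a | rank-∷-< v x<b = m≤n⇒m≤1+n (rank-mono a b v (onTail h))
... | no x≮a | no x≮b rewrite rank-∷-≮ v x≮a | rank-∷-≮ v x≮b = rank-mono a b v (onTail h)

rank-cong : ∀ {k} a b (u v : Vec ℕ k) → (∀ i → i < k → (u ! i < a) ⇔ (v ! i < b)) → rank a u ≡ rank b v
rank-cong a b [] [] _ = refl
rank-cong a b (x ∷ u) (y ∷ v) h with x <? a | y <? b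
... | yes x<a | yes y<b rewrite rank-∷-< u x<a | rank-∷-< v y<b = cong suc (rank-cong a b u v (onTail h))
... | yes x<a | no y≮b = contradiction (to (h 0 z<s) x<a) y≮b
... | no x≮a | yes y<b = contradiction (from (h 0 z<s) y<b) x≮a
... | no x≮a | no y≮b rewrite rank-∷-≮ u x≮a | rank-∷-≮ v y≮b = rank-cong a b u v (onTail h)

rank-mono-strict : ∀ {k} a b (v : Vec ℕ k) i → i < k → v ! i ≮ a → v ! i < b →
  (∀ j → j < k → v ! j < a → v ! j < b) → rank a v < rank b v
rank-mono-strict a b (x ∷ v) zero _ x≮a x<b h rewrite rank-∷-≮ v x≮a | rank-∷-< v x<b =
  s≤s (rank-mono a b v (onTail h))
rank-mono-strict a b (x ∷ v) (suc i) (s≤s i<k) vi≮a vi<b h with x <? a | x <? b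
... | yes x<a | yes x<b rewrite rank-∷-< v x<a | rank-∷-< v x<b =
  s≤s (rank-mono-strict a b v i i<k vi≮a vi<b (onTail h))
... | yes x<a | no x≮b = contradiction (h 0 z<s x<a) x≮b
... | no x≮a | yes x<b rewrite rank-∷-≮ v x≮a | rank-∷-< v x<b =
  m<n⇒m<1+n (rank-mono-strict a b v i i<k vi≮a vi<b (onTail h))
... | no x≮a | no x≮b rewrite rank-∷-≮ v x≮a | rank-∷-≮ v x≮b =
  rank-mono-strict a b v i i<k vi≮a vi<b (onTail h)

rank<length : ∀ {k} a (v : Vec ℕ k) i → i < k → v ! i ≮ a → rank a v < k
rank<length a (x ∷ v) zero _ x≮a rewrite rank-∷-≮ v x≮a = s≤s (count≤n (_<? a) v)
rank<length a (x ∷ v) (suc i) (s≤s i<k) vi≮a with x <? a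
... | yes x<a rewrite rank-∷-< v x<a = s≤s (rank<length a v i i<k vi≮a)
... | no x≮a rewrite rank-∷-≮ v x≮a = m<n⇒m<1+n (rank<length a v i i<k vi≮a)

rank-upperBound : ∀ {k} a (v : Vec ℕ k) → (∀ i → i < k → v ! i < a) → rank a v ≡ k
rank-upperBound a [] _ = refl
rank-upperBound a (x ∷ v) h rewrite rank-∷-< v (h 0 z<s) = cong suc (rank-upperBound a v (onTail h))

rank-suc : ∀ {k} x (v : Vec ℕ k) → Injective v → rank (suc x) v ≤ suc (rank x v)
rank-suc x [] _ = z≤n
rank-suc x (y ∷ v) injective with <-cmp y x
... | tri< y<x _ _ rewrite rank-∷-< v (m<n⇒m<1+n y<x) | rank-∷-< v y<x =
  s≤s (rank-suc x v (injective-tail injective))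
... | tri≈ _ refl _ rewrite rank-∷-< v (n<1+n y) | rank-∷-≮ v (n≮n y) =
  s≤s (rank-mono (suc y) y v λ i i<k vi<1+y → ≤∧≢⇒< (≤-pred vi<1+y) (vi≢y i i<k))
  where
  vi≢y : ∀ i → i < _ → v ! i ≢ y
  vi≢y i i<k eq with injective (suc i) 0 (s≤s i<k) z<s eq
  ... | ()
... | tri> _ _ x<y rewrite rank-∷-≮ v (λ y<1+x → <⇒≱ x<y (≤-pred y<1+x)) | rank-∷-≮ v (<-asym x<y) =
  rank-suc x v (injective-tail injective)

rank-+ : ∀ {k} (v : Vec ℕ k) → Injective v → ∀ d x → rank (d + x) v ≤ d + rank x v
rank-+ v injective zero x = ≤-refl
rank-+ v injective (suc d) x = ≤-trans (rank-suc (d + x) v injective) (s≤s (rank-+ v injective d x))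

-- rank goes from 0 (at 0) to k (at k) in steps of at most one, so it is the identity on [0, k].
rank-permutation : ∀ {k} (v : Vec ℕ k) → Permutation v → ∀ x → x ≤ k → rank x v ≡ x
rank-permutation {k} v (permutation bounded injective) x x≤k = ≤-antisym rank≤x x≤rank
  where
  rank≤x : rank x v ≤ x
  rank≤x = subst₂ (λ a b → rank a v ≤ b) (+-identityʳ x) (trans (cong (x +_) (rank-zero v)) (+-identityʳ x))
                  (rank-+ v injective x 0)
  x≤rank : x ≤ rank x v
  x≤rank = +-cancelˡ-≤ (k ∸ x) x (rank x v)
    (subst (_≤ (k ∸ x) + rank x v)
      (trans (cong (λ y → rank y v) (m∸n+n≡m x≤k)) (trans (rank-upperBound k v bounded) (sym (m∸n+n≡m x≤k))))
      (rank-+ v injective (k ∸ x) x))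

!-Order : ∀ {k} (v : Vec ℕ k) i → i < k → Order v ! i ≡ rank (v ! i) v
!-Order v = !-map (λ y → rank y v) v

Order-≅ : ∀ {k} (v : Vec ℕ k) → Order v ≅ v
Order-≅ v = sameOrder λ i j i<k j<k →
  subst₂ (λ x y → (x < y) ⇔ (v ! i < v ! j)) (sym (!-Order v i i<k)) (sym (!-Order v j j<k))
    (mk⇔ (rank<rank⇒< i j) λ vi<vj → rank-mono-strict (v ! i) (v ! j) v i i<k (n≮n _) vi<vj λ _ _ x<vi → <-trans x<vi vi<vj)
  where
  rank<rank⇒< : ∀ i j → rank (v ! i) v < rank (v ! j) v → v ! i < v ! j
  rank<rank⇒< i j r with v ! i <? v ! j
  ... | yes vi<vj = vi<vj
  ... | no vi≮vj = contradiction (rank-mono (v ! j) (v ! i) v λ _ _ x<vj → <-≤-trans x<vj (≮⇒≥ vi≮vj)) (<⇒≱ r)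

Order-cong : ∀ {k} {u v : Vec ℕ k} → u ≅ v → Order u ≡ Order v
Order-cong {k} {u} {v} h = !-ext (Order u) (Order v) λ i i<k → begin
  Order u ! i        ≡⟨ !-Order u i i<k ⟩
  rank (u ! i) u     ≡⟨ rank-cong (u ! i) (v ! i) u v (λ j j<k → agree h j i j<k i<k) ⟩
  rank (v ! i) v     ≡⟨ !-Order v i i<k ⟨
  Order v ! i        ∎
  where open ≡-Reasoning

Order-permutation : ∀ {k} (v : Vec ℕ k) → Injective v → Permutation (Order v)
Order-permutation v v-injective = permutation
  (λ i i<k → subst (_< _) (sym (!-Order v i i<k)) (rank<length (v ! i) v i i<k (n≮n _)))
  (≅-injective (Order-≅ v) v-injective)

Order-permutation-id : ∀ {k} (v : Vec ℕ k) → Permutation v → Order v ≡ v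
Order-permutation-id v perm = !-ext (Order v) v λ i i<k →
  trans (!-Order v i i<k) (rank-permutation v perm (v ! i) (<⇒≤ (bounded perm i i<k)))

≅-permutation⇒≡ : ∀ {k} {u v : Vec ℕ k} → Permutation u → Permutation v → u ≅ v → u ≡ v
≅-permutation⇒≡ {u = u} {v} perm-u perm-v h =
  trans (sym (Order-permutation-id u perm-u)) (trans (Order-cong h) (Order-permutation-id v perm-v))

Order-≅-permutation : ∀ {k} {u v : Vec ℕ k} → u ≅ v → Permutation v → Order u ≡ v
Order-≅-permutation {v = v} h perm = trans (Order-cong h) (Order-permutation-id v perm)

Order≡⇒≅ : ∀ {k} {u v : Vec ℕ k} → Order u ≡ v → u ≅ v
Order≡⇒≅ {u = u} eq = SameOrder-trans (SameOrder-sym (Order-≅ u)) (≡⇒≅ eq)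

ρ′≡ρ⇒≅ : ∀ {k} (e : Vec ℕ (suc k)) {e′ : Vec ℕ (suc k)} → ρ′ e ≡ ρ e′ → tail e ≅ init e′
ρ′≡ρ⇒≅ e {e′} eq = SameOrder-trans (Order≡⇒≅ eq) (Order-≅ (init e′))

ρ-Order : ∀ {k} (v : Vec ℕ (suc k)) → ρ (Order v) ≡ ρ v
ρ-Order v = Order-cong (≅-init (Order-≅ v))

ρ′-Order : ∀ {k} (v : Vec ℕ (suc k)) → ρ′ (Order v) ≡ ρ′ v
ρ′-Order v = Order-cong (≅-tail (Order-≅ v))

ρ-IsPerm : ∀ {k} (v : Vec ℕ (suc k)) → IsPerm (suc k) v → IsPerm k (ρ v)
ρ-IsPerm v perm =
  Permutation⇒IsPerm (Order-permutation (init v) (injective-init (injective (IsPerm⇒Permutation {v = v} perm))))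

ρ′-IsPerm : ∀ {k} (v : Vec ℕ (suc k)) → IsPerm (suc k) v → IsPerm k (ρ′ v)
ρ′-IsPerm (_ ∷ v) perm =
  Permutation⇒IsPerm (Order-permutation v (injective-tail (injective (IsPerm⇒Permutation {v = _ ∷ v} perm))))

-- Both sides are the pattern of the middle k entries of e.
ρ∘ρ′≡ρ′∘ρ : ∀ {k} (e : Vec ℕ (suc (suc k))) → ρ (ρ′ e) ≡ ρ′ (ρ e)
ρ∘ρ′≡ρ′∘ρ (x ∷ e) = Order-cong (SameOrder-trans (≅-init (Order-≅ e)) (SameOrder-sym (≅-tail (Order-≅ (init (x ∷ e))))))

-- Appending an entry in a prescribed relative position

≅-∷ʳ : ∀ {k} {u v : Vec ℕ k} {x y} → u ≅ v →
  (∀ j → j < k → (u ! j < x) ⇔ (v ! j < y)) →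
  (∀ j → j < k → (x < u ! j) ⇔ (y < v ! j)) →
  u ∷ʳ x ≅ v ∷ʳ y
≅-∷ʳ {k} {u} {v} {x} {y} (sameOrder h) below above =
  sameOrder λ i j i<1+k j<1+k → cases i j (<-suc-cases i<1+k) (<-suc-cases j<1+k)
  where
  cases : ∀ i j → i < k ⊎ i ≡ k → j < k ⊎ j ≡ k →
          ((u ∷ʳ x) ! i < (u ∷ʳ x) ! j) ⇔ ((v ∷ʳ y) ! i < (v ∷ʳ y) ! j)
  cases i j (inj₁ i<k) (inj₁ j<k)
    rewrite !-∷ʳ u x i i<k | !-∷ʳ u x j j<k | !-∷ʳ v y i i<k | !-∷ʳ v y j j<k = h i j i<k j<k
  cases i _ (inj₁ i<k) (inj₂ refl)
    rewrite !-∷ʳ u x i i<k | !-∷ʳ v y i i<k | !-∷ʳ-last u x | !-∷ʳ-last v y = below i i<k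
  cases _ j (inj₂ refl) (inj₁ j<k)
    rewrite !-∷ʳ u x j j<k | !-∷ʳ v y j j<k | !-∷ʳ-last u x | !-∷ʳ-last v y = above j j<k
  cases _ _ (inj₂ refl) (inj₂ refl)
    rewrite !-∷ʳ-last u x | !-∷ʳ-last v y = mk⇔ (⊥-elim ∘ n≮n x) (⊥-elim ∘ n≮n y)

injective-∷ʳ : ∀ {k} {v : Vec ℕ k} {x} → Injective v → (∀ j → j < k → v ! j ≢ x) → Injective (v ∷ʳ x)
injective-∷ʳ {k} {v} {x} v-injective fresh i j i<1+k j<1+k = cases (<-suc-cases i<1+k) (<-suc-cases j<1+k)
  where
  cases : i < k ⊎ i ≡ k → j < k ⊎ j ≡ k → (v ∷ʳ x) ! i ≡ (v ∷ʳ x) ! j → i ≡ j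
  cases (inj₁ i<k) (inj₁ j<k) rewrite !-∷ʳ v x i i<k | !-∷ʳ v x j j<k = v-injective i j i<k j<k
  cases (inj₁ i<k) (inj₂ refl) rewrite !-∷ʳ v x i i<k | !-∷ʳ-last v x = ⊥-elim ∘ fresh i i<k
  cases (inj₂ refl) (inj₁ j<k) rewrite !-∷ʳ v x j j<k | !-∷ʳ-last v x = ⊥-elim ∘ fresh j j<k ∘ sym
  cases (inj₂ refl) (inj₂ refl) _ = refl

∷ʳ-injective-fresh : ∀ {k} {v : Vec ℕ k} {x} → Injective (v ∷ʳ x) → ∀ j → j < k → v ! j ≢ x
∷ʳ-injective-fresh {k} {v} {x} injective j j<k vj≡x =
  <-irrefl (injective j k (m<n⇒m<1+n j<k) (n<1+n k) (trans (!-∷ʳ v x j j<k) (trans vj≡x (sym (!-∷ʳ-last v x))))) j<k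

odd : ℕ → ℕ
odd a = suc (2 * a)

odd-<⇔ : ∀ {a b} → (a < b) ⇔ (odd a < odd b)
odd-<⇔ {a} {b} = mk⇔ (λ a<b → s≤s (*-monoʳ-< 2 a<b)) (λ odd< → *-cancelˡ-< 2 a b (≤-pred odd<))

odd<even : ∀ {a m} → a < m → odd a < 2 * m
odd<even {a} {m} a<m = subst (_≤ 2 * m) (*-suc 2 a) (*-monoʳ-≤ 2 a<m)

even<odd : ∀ {m a} → m ≤ a → 2 * m < odd a
even<odd m≤a = s≤s (*-monoʳ-≤ 2 m≤a)

map-odd-≅ : ∀ {k} (u : Vec ℕ k) → map odd u ≅ u
map-odd-≅ u = sameOrder λ i j i<k j<k →
  subst₂ (λ x y → (x < y) ⇔ (u ! i < u ! j)) (sym (!-map odd u i i<k)) (sym (!-map odd u j j<k)) (⇔.sym odd-<⇔)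

maxBelow : ∀ {k} → Vec ℕ k → Vec ℕ k → ℕ → ℕ
maxBelow [] [] t = 0
maxBelow (a ∷ u) (b ∷ bs) t with b <? t
... | yes _ = suc a ⊔ maxBelow u bs t
... | no _ = maxBelow u bs t

maxBelow-upper : ∀ {k} (u b : Vec ℕ k) t j → j < k → b ! j < t → u ! j < maxBelow u b t
maxBelow-upper (a ∷ u) (b ∷ bs) t zero _ b<t with b <? t
... | yes _ = m≤m⊔n (suc a) (maxBelow u bs t)
... | no b≮t = contradiction b<t b≮t
maxBelow-upper (a ∷ u) (b ∷ bs) t (suc j) (s≤s j<k) bj<t with b <? t
... | yes _ = m≤n⇒m≤o⊔n (suc a) (maxBelow-upper u bs t j j<k bj<t)
... | no _ = maxBelow-upper u bs t j j<k bj<t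

maxBelow-least : ∀ {k} (u b : Vec ℕ k) t c → (∀ j → j < k → b ! j < t → u ! j < c) → maxBelow u b t ≤ c
maxBelow-least [] [] t c _ = z≤n
maxBelow-least (a ∷ u) (b ∷ bs) t c h with b <? t
... | yes b<t = ⊔-lub (h 0 z<s b<t) (maxBelow-least u bs t c (onTail h))
... | no _ = maxBelow-least u bs t c (onTail h)

same-side : ∀ {p q t x} → q ≢ t → (q < t → p < x) → (t < q → x < p) →
  ((p < x) ⇔ (q < t)) × ((x < p) ⇔ (t < q))
same-side {p} {q} {t} {x} q≢t below above with <-cmp q t
... | tri< q<t _ _ = mk⇔ (λ _ → q<t) (λ _ → below q<t) , mk⇔ (λ x<p → contradiction x<p (<-asym (below q<t))) (λ t<q → contradiction t<q (<-asym q<t))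
... | tri≈ _ q≡t _ = contradiction q≡t q≢t
... | tri> _ _ t<q = mk⇔ (λ p<x → contradiction p<x (<-asym (above t<q))) (λ q<t → contradiction q<t (<-asym t<q)) , mk⇔ (λ _ → t<q) (λ _ → above t<q)

-- Appending 2 · maxBelow u b t to the odd entries 2u+1 puts it exactly between
-- the entries whose b-counterparts lie below t and those lying above t.
∷ʳ-maxBelow-≅ : ∀ {k} {u b : Vec ℕ k} {t} → u ≅ b → Injective (b ∷ʳ t) →
  map odd u ∷ʳ 2 * maxBelow u b t ≅ b ∷ʳ t
∷ʳ-maxBelow-≅ {k} {u} {b} {t} h injective =
  ≅-∷ʳ (SameOrder-trans (map-odd-≅ u) h) (λ j j<k → proj₁ (side j j<k)) (λ j j<k → proj₂ (side j j<k))
  where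
  M = maxBelow u b t
  side : ∀ j → j < k → ((map odd u ! j < 2 * M) ⇔ (b ! j < t)) × ((2 * M < map odd u ! j) ⇔ (t < b ! j))
  side j j<k rewrite !-map odd u j j<k = same-side (∷ʳ-injective-fresh {v = b} injective j j<k)
    (λ bj<t → odd<even (maxBelow-upper u b t j j<k bj<t))
    (λ t<bj → even<odd (maxBelow-least u b t (u ! j) λ l l<k bl<t → from (agree h l j l<k j<k) (<-trans bl<t t<bj)))

window : ∀ {n} (i : ℕ) → Vec ℕ (suc (i + n)) → Vec ℕ (suc n)
window zero w = w
window (suc i) w = window i (tail w)

window-∷ʳ : ∀ {n} i (xs : Vec ℕ (i + n)) x → window i (xs ∷ʳ x) ≡ drop i xs ∷ʳ x
window-∷ʳ zero xs x = refl
window-∷ʳ (suc i) (y ∷ xs) x = window-∷ʳ i xs x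

tail-window : ∀ {n} i (w : Vec ℕ (suc (i + n))) → tail (window i w) ≡ drop (suc i) w
tail-window zero (x ∷ w) = refl
tail-window (suc i) (x ∷ w) = tail-window i w

window-≅ : ∀ {n} i {u v : Vec ℕ (suc (i + n))} → u ≅ v → window i u ≅ window i v
window-≅ zero h = h
window-≅ (suc i) h = window-≅ i (≅-tail h)

init∷ʳlast : ∀ {k} (e : Vec ℕ (suc k)) → init e ∷ʳ last e ≡ e
init∷ʳlast e = sym (proj₂ (proj₂ (initLast e)))

extend : ∀ {n} i → Vec ℕ (i + n) → Vec ℕ (suc n) → Vec ℕ (suc (i + n))
extend i w e = map odd w ∷ʳ 2 * maxBelow (drop i w) (init e) (last e)

init-extend-≅ : ∀ {n} i (w : Vec ℕ (i + n)) e → init (extend i w e) ≅ w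
init-extend-≅ i w e = SameOrder-trans (≡⇒≅ (init-∷ʳ _ (map odd w))) (map-odd-≅ w)

extend-injective : ∀ {n} i (w : Vec ℕ (i + n)) e → Injective w → Injective (extend i w e)
extend-injective i w e w-injective = injective-∷ʳ {v = map odd w} (≅-injective (map-odd-≅ w) w-injective)
  λ j j<k eq → even≢odd (maxBelow (drop i w) (init e) (last e)) (w ! j) (sym (trans (sym (!-map odd w j j<k)) eq))

window-extend-≅ : ∀ {n} i (w : Vec ℕ (i + n)) e → drop i w ≅ init e → Injective e → window i (extend i w e) ≅ e
window-extend-≅ i w e h e-injective = subst₂ _≅_
  (sym (trans (window-∷ʳ i (map odd w) x) (cong (_∷ʳ x) (drop-map odd i w))))
  (init∷ʳlast e)
  (∷ʳ-maxBelow-≅ h (subst (λ v → Injective v) (sym (init∷ʳlast e)) e-injective))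
  where x = 2 * maxBelow (drop i w) (init e) (last e)

glue : ∀ {k} → Vec ℕ (suc k) → Vec ℕ (suc k) → Vec ℕ (suc (suc k))
glue e e′ = Order (extend 1 e e′)

glue-edge : ∀ {k} {e e′ : Vec ℕ (suc k)} → IsPerm (suc k) e → IsPerm (suc k) e′ → ρ′ e ≡ ρ e′ →
  IsPerm (suc (suc k)) (glue e e′) × ρ (glue e e′) ≡ e × ρ′ (glue e e′) ≡ e′
glue-edge {k} {e} {e′} e-perm e′-perm consecutive =
  Permutation⇒IsPerm (Order-permutation X (extend-injective 1 e e′ (injective e-Perm))) ,
  trans (ρ-Order X) (Order-≅-permutation (init-extend-≅ 1 e e′) e-Perm) ,
  trans (ρ′-Order X) (Order-≅-permutation (window-extend-≅ 1 e e′ (tail≅init e consecutive) (injective e′-Perm)) e′-Perm)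
  where
  X = extend 1 e e′
  e-Perm = IsPerm⇒Permutation {v = e} e-perm
  e′-Perm = IsPerm⇒Permutation {v = e′} e′-perm
  tail≅init : ∀ (e : Vec ℕ (suc k)) → ρ′ e ≡ ρ e′ → drop 1 e ≅ init e′
  tail≅init e@(_ ∷ _) = ρ′≡ρ⇒≅ e

-- Lifting paths

Steps : ℕ → Set
Steps k = List (Vec ℕ (suc k) × Vec ℕ k)

edgeStep : ∀ {k} → Vec ℕ (suc k) → Vec ℕ (suc k) × Vec ℕ k
edgeStep e = e , ρ′ e

π1-step : ∀ {k} → Vec ℕ (suc (suc k)) × Vec ℕ (suc k) → Vec ℕ (suc k) × Vec ℕ k
π1-step st = edgeStep (proj₂ st)

π1-PathFrom : ∀ {k} {v : Vec ℕ (suc k)} (steps : Steps (suc k)) → IsPerm (suc k) v → PathFrom v steps →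
  PathFrom (ρ′ v) (List.map π1-step steps)
π1-PathFrom [] _ _ = tt
π1-PathFrom ((e , w) ∷ steps) _ (_ , ρe≡v , ρ′e≡w , w-perm , path) =
  w-perm , trans (cong ρ (sym ρ′e≡w)) (trans (ρ∘ρ′≡ρ′∘ρ e) (cong ρ′ ρe≡v)) , refl , ρ′-IsPerm w w-perm ,
  π1-PathFrom steps w-perm path

π1-IsPath : ∀ {k} (p : Walk (suc k)) → IsPath p → IsPath (π1 p)
π1-IsPath (v₀ , steps) (v₀-perm , path) =
  ρ-IsPerm v₀ v₀-perm , v₀-perm , refl , refl , ρ′-IsPerm v₀ v₀-perm , π1-PathFrom steps v₀-perm path

π-IsPath : ∀ d {n} (p : Walk (d + n)) → IsPath p → IsPath (π d p)
π-IsPath zero p path = path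
π-IsPath (suc d) p path = π-IsPath d (π1 p) (π1-IsPath p path)

len-π : ∀ d {n} (p : Walk (d + n)) → len (π d p) ≡ d + len p
len-π zero p = refl
len-π (suc d) (v₀ , steps) = begin
  len (π d (π1 (v₀ , steps)))      ≡⟨ len-π d (π1 (v₀ , steps)) ⟩
  d + suc (List.length (List.map π1-step steps)) ≡⟨ cong (λ l → d + suc l) (List.length-map π1-step steps) ⟩
  d + suc (List.length steps)      ≡⟨ +-suc d _ ⟩
  suc d + List.length steps        ∎
  where open ≡-Reasoning

liftSteps : ∀ {k} → Vec ℕ (suc k) → Steps k → Steps (suc k)
liftSteps e [] = []
liftSteps e ((e′ , _) ∷ steps) = (glue e e′ , e′) ∷ liftSteps e′ steps

liftSteps-PathFrom : ∀ {k} {e : Vec ℕ (suc k)} {v} (steps : Steps k) → IsPerm (suc k) e → ρ′ e ≡ v → PathFrom v steps →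
  PathFrom e (liftSteps e steps) × List.map π1-step (liftSteps e steps) ≡ steps
liftSteps-PathFrom [] _ _ _ = tt , refl
liftSteps-PathFrom ((e′ , v′) ∷ steps) e-perm ρ′e≡v (e′-perm , ρe′≡v , ρ′e′≡v′ , _ , path) =
  let glue-perm , ρ-glue , ρ′-glue = glue-edge e-perm e′-perm (trans ρ′e≡v (sym ρe′≡v))
      lifted-path , π1-lifted = liftSteps-PathFrom steps e′-perm ρ′e′≡v′ path
  in (glue-perm , ρ-glue , ρ′-glue , e′-perm , lifted-path) , cong₂ _∷_ (cong (e′ ,_) ρ′e′≡v′) π1-lifted

π1-lift : ∀ {k} (p : Walk k) → IsPath p → 1 ≤ len p → Σ (Walk (suc k)) λ q → IsPath q × π1 q ≡ p
π1-lift (v₀ , (e₁ , v₁) ∷ steps) (_ , e₁-perm , ρe₁≡v₀ , ρ′e₁≡v₁ , _ , path) _ =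
  let lifted-path , π1-lifted = liftSteps-PathFrom steps e₁-perm ρ′e₁≡v₁ path
  in (e₁ , liftSteps e₁ steps) , (e₁-perm , lifted-path) ,
     cong₂ _,_ ρe₁≡v₀ (cong₂ _∷_ (cong (e₁ ,_) ρ′e₁≡v₁) π1-lifted)

π-lift : ∀ d {n} (p : Walk n) → IsPath p → d ≤ len p → Σ (Walk (d + n)) λ q → IsPath q × π d q ≡ p
π-lift zero p path _ = p , path , refl
π-lift (suc d) p path d<len with π-lift d p path (<⇒≤ d<len)
... | q , q-path , πq≡p =
  let r , r-path , π1r≡q = π1-lift q q-path (+-cancelˡ-≤ d 1 (len q) (subst (d + 1 ≤_) len-p (subst (_≤ len p) (+-comm 1 d) d<len)))
  in r , r-path , trans (cong (π d) π1r≡q) πq≡p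
  where
  len-p : len p ≡ d + len q
  len-p = trans (sym (cong len πq≡p)) (len-π d q)

lift∞ : ∀ {k} → InfWalk k → InfWalk (suc k)
lift∞ (_ , s) = proj₁ (s 0) , λ i → glue (proj₁ (s i)) (proj₁ (s (suc i))) , proj₁ (s (suc i))

lift∞-IsInfPath : ∀ {k} (p : InfWalk k) → IsInfPath p → IsInfPath (lift∞ p)
lift∞-IsInfPath (v₀ , s) (_ , step) = proj₁ (step 0) , λ i →
  let glue-perm , ρ-glue , ρ′-glue = glue-edge (proj₁ (step i)) (proj₁ (step (suc i)))
        (trans (proj₁ (proj₂ (proj₂ (step i)))) (sym (proj₁ (proj₂ (step (suc i))))))
  in glue-perm , trans ρ-glue (sym (vertex-lift∞ i)) , ρ′-glue , proj₁ (step (suc i))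
  where
  vertex-lift∞ : ∀ i → vertexAt (lift∞ (v₀ , s)) i ≡ proj₁ (s i)
  vertex-lift∞ zero = refl
  vertex-lift∞ (suc i) = refl

π1∞-lift∞ : ∀ {k} (p : InfWalk k) → IsInfPath p → π1∞ (lift∞ p) ≈∞ p
π1∞-lift∞ (v₀ , s) (_ , step) = proj₁ (proj₂ (step 0)) , λ
  { zero → cong (proj₁ (s 0) ,_) (ρ′e≡v 0)
  ; (suc i) → cong (proj₁ (s (suc i)) ,_) (ρ′e≡v (suc i)) }
  where
  ρ′e≡v : ∀ i → ρ′ (proj₁ (s i)) ≡ proj₂ (s i)
  ρ′e≡v i = proj₁ (proj₂ (proj₂ (step i)))

≈∞-trans : ∀ {k} {p q r : InfWalk k} → p ≈∞ q → q ≈∞ r → p ≈∞ r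
≈∞-trans (v≡v′ , s≗s′) (v′≡v″ , s′≗s″) = trans v≡v′ v′≡v″ , λ i → trans (s≗s′ i) (s′≗s″ i)

π1∞-cong : ∀ {k} {p q : InfWalk (suc k)} → p ≈∞ q → π1∞ p ≈∞ π1∞ q
π1∞-cong {p = v , s} {v′ , s′} (v≡v′ , s≗s′) = cong ρ v≡v′ , λ
  { zero → cong (λ x → x , ρ′ x) v≡v′
  ; (suc i) → cong π1-step (s≗s′ i) }

π∞-cong : ∀ d {n} {p q : InfWalk (d + n)} → p ≈∞ q → π∞ d p ≈∞ π∞ d q
π∞-cong zero p≈q = p≈q
π∞-cong (suc d) p≈q = π∞-cong d (π1∞-cong p≈q)

π∞-lift : ∀ d {n} (p : InfWalk n) → IsInfPath p → Σ (InfWalk (d + n)) λ q → IsInfPath q × π∞ d q ≈∞ p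
π∞-lift zero p path = p , path , refl , λ _ → refl
π∞-lift (suc d) p path with π∞-lift d p path
... | q , q-path , πq≈p = lift∞ q , lift∞-IsInfPath q q-path , ≈∞-trans (π∞-cong d (π1∞-lift∞ q q-path)) πq≈p

-- π_n on S_∞

ρ′^ : ∀ {n} d → Vec ℕ (suc (d + n)) → Vec ℕ (suc n)
ρ′^ zero e = e
ρ′^ (suc d) e = ρ′^ d (ρ′ e)

π-∷ʳ-edgeStep : ∀ d {n} (v : Vec ℕ (d + n)) steps e →
  π d (v , steps List.∷ʳ edgeStep e) ≡ (proj₁ (π d (v , steps)) , proj₂ (π d (v , steps)) List.∷ʳ edgeStep (ρ′^ d e))
π-∷ʳ-edgeStep zero v steps e = refl
π-∷ʳ-edgeStep (suc d) v steps e =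
  trans (cong (λ steps′ → π d (ρ v , edgeStep v ∷ steps′)) (List.map-++ π1-step steps _))
        (π-∷ʳ-edgeStep d (ρ v) (edgeStep v ∷ List.map π1-step steps) (ρ′ e))

-- π_n(σ): its i-th edge is the pattern of the last n + 1 entries of σ_{i+n+1}.
π-S∞ : (n : ℕ) → ((i : ℕ) → Vec ℕ i) → InfWalk n
π-S∞ n σ = σ n , λ i → edgeStep (ρ′^ i (σ (suc (i + n))))

takeInf-π-S∞ : ∀ n (σ : (i : ℕ) → Vec ℕ i) → (∀ i → ρ (σ (suc i)) ≡ σ i) →
  ∀ ℓ → π ℓ (σ (ℓ + n) , []) ≡ takeInf ℓ (π-S∞ n σ)
takeInf-π-S∞ n σ coherent zero = refl
takeInf-π-S∞ n σ coherent (suc ℓ) = begin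
  π ℓ (ρ σℓ+n+1 , edgeStep σℓ+n+1 ∷ [])
    ≡⟨ cong (λ v → π ℓ (v , [] List.∷ʳ edgeStep σℓ+n+1)) (coherent (ℓ + n)) ⟩
  π ℓ (σ (ℓ + n) , [] List.∷ʳ edgeStep σℓ+n+1)
    ≡⟨ π-∷ʳ-edgeStep ℓ (σ (ℓ + n)) [] σℓ+n+1 ⟩
  (proj₁ (π ℓ (σ (ℓ + n) , [])) , proj₂ (π ℓ (σ (ℓ + n) , [])) List.∷ʳ edgeStep (ρ′^ ℓ σℓ+n+1))
    ≡⟨ cong (λ w → proj₁ w , proj₂ w List.∷ʳ edgeStep (ρ′^ ℓ σℓ+n+1)) (takeInf-π-S∞ n σ coherent ℓ) ⟩
  (σ n , applyUpTo (proj₂ (π-S∞ n σ)) ℓ List.∷ʳ proj₂ (π-S∞ n σ) ℓ)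
    ≡⟨ cong (σ n ,_) (List.applyUpTo-∷ʳ (proj₂ (π-S∞ n σ)) ℓ) ⟩
  takeInf (suc ℓ) (π-S∞ n σ) ∎
  where
  open ≡-Reasoning
  σℓ+n+1 = σ (suc (ℓ + n))

PathFrom-applyUpTo : ∀ {k} (v : Vec ℕ k) s i → PathFrom v (applyUpTo s (suc i)) →
  IsPerm (suc k) (proj₁ (s i)) × ρ (proj₁ (s i)) ≡ vertexAt (v , s) i ×
  ρ′ (proj₁ (s i)) ≡ vertexAt (v , s) (suc i) × IsPerm k (proj₂ (s i))
PathFrom-applyUpTo v s zero (e-perm , ρe , ρ′e , v′-perm , _) = e-perm , ρe , ρ′e , v′-perm
PathFrom-applyUpTo v s (suc i) (_ , _ , _ , _ , path) with PathFrom-applyUpTo (proj₂ (s 0)) (s ∘ suc) i path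
... | e-perm , ρe , ρ′e , v′-perm = e-perm , trans ρe (vertexAt-suc i) , ρ′e , v′-perm
  where
  vertexAt-suc : ∀ i → vertexAt (proj₂ (s 0) , s ∘ suc) i ≡ vertexAt (v , s) (suc i)
  vertexAt-suc zero = refl
  vertexAt-suc (suc i) = refl

IsInfPath-from-prefixes : ∀ {k} (p : InfWalk k) → (∀ ℓ → IsPath (takeInf ℓ p)) → IsInfPath p
IsInfPath-from-prefixes (v₀ , s) prefix = proj₁ (prefix 0) , λ i → PathFrom-applyUpTo v₀ s i (proj₂ (prefix (suc i)))

π-S∞-IsInfPath : ∀ n (σ : (i : ℕ) → Vec ℕ i) → IsSInf σ → IsInfPath (π-S∞ n σ)
π-S∞-IsInfPath n σ (σ-perm , coherent) = IsInfPath-from-prefixes (π-S∞ n σ) λ ℓ →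
  subst IsPath (takeInf-π-S∞ n σ coherent ℓ) (π-IsPath ℓ (σ (ℓ + n) , []) (σ-perm (ℓ + n) , tt))

ρ′^-≅-window : ∀ {n} d (e : Vec ℕ (suc (d + n))) → ρ′^ d e ≅ window d e
ρ′^-≅-window zero e = SameOrder-refl
ρ′^-≅-window (suc d) e = SameOrder-trans (ρ′^-≅-window d (ρ′ e)) (window-≅ d (Order-≅ (tail e)))

ρ′^-Permutation : ∀ {n} d {e : Vec ℕ (suc (d + n))} → Permutation e → Permutation (ρ′^ d e)
ρ′^-Permutation zero perm = perm
ρ′^-Permutation (suc d) {_ ∷ e} perm = ρ′^-Permutation d (Order-permutation e (injective-tail (injective perm)))

takeInf-cong : ∀ {k} {p q : InfWalk k} → p ≈∞ q → ∀ ℓ → takeInf ℓ p ≡ takeInf ℓ q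
takeInf-cong {k} {v , s} {v′ , s′} (v≡v′ , s≗s′) ℓ = cong₂ _,_ v≡v′ (applyUpTo-cong s≗s′ ℓ)
  where
  applyUpTo-cong : ∀ {s s′ : ℕ → Vec ℕ (suc k) × Vec ℕ k} → (∀ i → s i ≡ s′ i) → ∀ ℓ → applyUpTo s ℓ ≡ applyUpTo s′ ℓ
  applyUpTo-cong s≗s′ zero = refl
  applyUpTo-cong s≗s′ (suc ℓ) = cong₂ _∷_ (s≗s′ 0) (applyUpTo-cong (s≗s′ ∘ suc) ℓ)

-- σ′ ℓ will be σ_{ℓ+n}; the σ_i with i < n are recovered as patterns of prefixes.
module FromInfPath {n} (v₀ : Vec ℕ n) (s : ℕ → Vec ℕ (suc n) × Vec ℕ n) (path : IsInfPath (v₀ , s)) where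

  e : ℕ → Vec ℕ (suc n)
  e i = proj₁ (s i)

  e-Perm : ∀ i → Permutation (e i)
  e-Perm i = IsPerm⇒Permutation {v = e i} (proj₁ (proj₂ path i))

  ρ′e≡v : ∀ i → ρ′ (e i) ≡ proj₂ (s i)
  ρ′e≡v i = proj₁ (proj₂ (proj₂ (proj₂ path i)))

  consecutive : ∀ i → tail (e i) ≅ init (e (suc i))
  consecutive i = ρ′≡ρ⇒≅ (e i) (trans (ρ′e≡v i) (sym (proj₁ (proj₂ (proj₂ path (suc i))))))

  σ′ : (ℓ : ℕ) → Vec ℕ (ℓ + n)
  σ′ zero = v₀
  σ′ (suc ℓ) = Order (extend ℓ (σ′ ℓ) (e ℓ))

  σ′-invariant : ∀ ℓ → Permutation (σ′ ℓ) × drop ℓ (σ′ ℓ) ≅ init (e ℓ)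
  window-σ′ : ∀ ℓ → window ℓ (σ′ (suc ℓ)) ≅ e ℓ

  σ′-invariant zero =
    IsPerm⇒Permutation {v = v₀} (proj₁ path) ,
    SameOrder-sym (Order≡⇒≅ (proj₁ (proj₂ (proj₂ path 0))))
  σ′-invariant (suc ℓ) =
    Order-permutation X (extend-injective ℓ (σ′ ℓ) (e ℓ) (injective (proj₁ (σ′-invariant ℓ)))) ,
    subst (_≅ init (e (suc ℓ))) (tail-window ℓ (σ′ (suc ℓ)))
      (SameOrder-trans (≅-tail (window-σ′ ℓ)) (consecutive ℓ))
    where X = extend ℓ (σ′ ℓ) (e ℓ)

  window-σ′ ℓ = SameOrder-trans (window-≅ ℓ (Order-≅ X))
    (window-extend-≅ ℓ (σ′ ℓ) (e ℓ) (proj₂ (σ′-invariant ℓ)) (injective (e-Perm ℓ)))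
    where X = extend ℓ (σ′ ℓ) (e ℓ)

  σ′-Perm : ∀ ℓ → Permutation (σ′ ℓ)
  σ′-Perm ℓ = proj₁ (σ′-invariant ℓ)

  σ′-suc : ∀ ℓ → SameOrder (ℓ + n) (σ′ (suc ℓ)) (σ′ ℓ)
  σ′-suc ℓ = to SameOrder-init (SameOrder-trans (≅-init (Order-≅ X)) (init-extend-≅ ℓ (σ′ ℓ) (e ℓ)))
    where X = extend ℓ (σ′ ℓ) (e ℓ)

  σ′-mono : ∀ {ℓ m} → ℓ ≤ m → SameOrder (ℓ + n) (σ′ m) (σ′ ℓ)
  σ′-mono {m = zero} z≤n = SameOrder-refl
  σ′-mono {ℓ} {suc m} ℓ≤1+m with m≤n⇒m<n∨m≡n ℓ≤1+m
  ... | inj₂ refl = SameOrder-refl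
  ... | inj₁ ℓ<1+m = SameOrder-trans (SameOrder-mono (+-monoˡ-≤ n ℓ≤m) (σ′-suc m)) (σ′-mono ℓ≤m)
    where ℓ≤m = ≤-pred ℓ<1+m

  σ : (i : ℕ) → Vec ℕ i
  σ i = Order (truncate (m≤m+n i n) (σ′ i))

  σ-IsSInf : IsSInf σ
  σ-IsSInf = σ-perm , σ-coherent
    where
    σ-perm : ∀ i → IsPerm i (σ i)
    σ-perm i = Permutation⇒IsPerm {v = σ i} (Order-permutation _ (injective-truncate (m≤m+n i n) {σ′ i} (injective (σ′-Perm i))))
    σ-coherent : ∀ i → ρ (σ (suc i)) ≡ σ i
    σ-coherent i = trans (ρ-Order T) (Order-cong (SameOrder-sym
        (SameOrder-truncate (m≤m+n i n) ≤-refl (SameOrder-sym init-T≅σ′))))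
      where
      T = truncate (m≤m+n (suc i) n) (σ′ (suc i))
      init-T≅σ′ : SameOrder i (init T) (σ′ i)
      init-T≅σ′ = from SameOrder-init (SameOrder-truncate (m≤m+n (suc i) n) (n≤1+n i)
        (SameOrder-mono (m≤m+n i n) (σ′-suc i)))

  σ-extends-σ′ : ∀ ℓ → σ (ℓ + n) ≡ σ′ ℓ
  σ-extends-σ′ ℓ = Order-≅-permutation (SameOrder-truncate (m≤m+n (ℓ + n) n) ≤-refl (σ′-mono (m≤m+n ℓ n))) (σ′-Perm ℓ)

  ρ′^-σ≡e : ∀ i → ρ′^ i (σ (suc i + n)) ≡ e i
  ρ′^-σ≡e i rewrite σ-extends-σ′ (suc i) = ≅-permutation⇒≡ (ρ′^-Permutation i (σ′-Perm (suc i))) (e-Perm i)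
    (SameOrder-trans (ρ′^-≅-window i (σ′ (suc i))) (window-σ′ i))

  π-S∞-σ≈p : π-S∞ n σ ≈∞ (v₀ , s)
  π-S∞-σ≈p = σ-extends-σ′ 0 , λ i → trans (cong edgeStep (ρ′^-σ≡e i)) (cong (e i ,_) (ρ′e≡v i))

  σ-IsπInf : IsπInf n σ (v₀ , s)
  σ-IsπInf ℓ = trans (sym (takeInf-cong π-S∞-σ≈p ℓ)) (sym (takeInf-π-S∞ n σ (proj₂ σ-IsSInf) ℓ))

lemma2p2 :
    ((d n : ℕ) → 1 ≤ n → (p : Walk n) → IsPath p → d ≤ len p →
      Σ (Walk (d + n)) (λ q → IsPath q × π d q ≡ p))
    × ((d n : ℕ) → 1 ≤ n → (p : InfWalk n) → IsInfPath p →
      Σ (InfWalk (d + n)) (λ q → IsInfPath q × π∞ d q ≈∞ p))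
    × ((n : ℕ) → 1 ≤ n → (σ : (i : ℕ) → Vec ℕ i) → IsSInf σ →
      Σ (InfWalk n) (λ p → IsInfPath p × IsπInf n σ p))
    × ((n : ℕ) → 1 ≤ n → (p : InfWalk n) → IsInfPath p →
      Σ ((i : ℕ) → Vec ℕ i) (λ σ → IsSInf σ × IsπInf n σ p))
lemma2p2 =
  (λ d n _ p path d≤len → π-lift d p path d≤len) ,
  (λ d n _ p path → π∞-lift d p path) ,
  (λ n _ σ σ∈S∞ → π-S∞ n σ , π-S∞-IsInfPath n σ σ∈S∞ , λ ℓ → sym (takeInf-π-S∞ n σ (proj₂ σ∈S∞) ℓ)) ,
  (λ { n _ (v₀ , s) path → let open FromInfPath v₀ s path in σ , σ-IsSInf , σ-IsπInf })
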